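{- Let $w_1=\langle A_1,D_1,n_1\rangle$ and $w_2=\langle A_2,D_2,n_2\rangle$ be indexed containers over $I_1$ and $I_2$, and let $(R,\rho):w_1\multimap w_2$ be a linear simulation. Then the type $$\prod_{i_1:I_1}\prod_{i_2:I_2}R(i_1,i_2)\to(i_1\in\nu_{w_1^\bot})\to(i_2\in\nu_{w_2^\bot})$$ is inhabited.
   Context: An indexed container over $I$ is $w=\langle A,D,n\rangle$ with $A(i):\mathsf{Set}$, $D(i,a):\mathsf{Set}$ and $n(i,a,d):I$, written $i[a/d]$. Its extension is $i\in[\![w]\!](X)=\sum_{a:A(i)}\prod_{d:D(i,a)}X(i[a/d])$. The dual is $w^\bot$ with $A^\bot(i)=\prod_{a:A(i)}D(i,a)$, $D^\bot(i,f)=A(i)$ and $n^\bot(i,f,a)=i[a/f\,a]$. The coinductive predicate $\nu_v$ has $\nu\mathrm{elim}:\nu_v\subseteq[\![v]\!](\nu_v)$ and $\nu\mathrm{intro}\,c:X\subseteq\nu_v$ for every $c:X\subseteq[\![v]\!](X)$. A linear simulation $(R,\rho):w_1\multimap w_2$ is a relation $R:I_1\times I_2\to\mathsf{Set}$ together with $\rho:\prod_{i_1,i_2}R(i_1,i_2)\to\prod_{a_2:A_2(i_2)}\sum_{a_1:A_1(i_1)}\prod_{d_1:D_1(i_1,a_1)}\sum_{d_2:D_2(i_2,a_2)}R(i_1[a_1/d_1],i_2[a_2/d_2])$. -}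

module Defs where

open import Level using (Level)
open import Data.Product using (Σ; _×_; _,_; proj₁; proj₂)

record IC (I : Set) : Set₁ where
  constructor ⟨_,_,_⟩
  field
    A : I → Set
    D : (i : I) → A i → Set
    n : (i : I) → (a : A i) → D i a → I
open IC public

⟦_⟧ : {ℓ : Level} {I : Set} → IC I → (I → Set ℓ) → I → Set ℓ
⟦ w ⟧ X i = Σ (A w i) λ a → (d : D w i a) → X (n w i a d)

_⊥ : {I : Set} → IC I → IC I
w ⊥ = record
  { A = λ i → (a : A w i) → D w i a
  ; D = λ i f → A w i
  ; n = λ i f a → n w i a (f a)
  }

-- Greatest fixed point ν_v, encoded as the union of all post-fixed points
-- (i ∈ ν_v iff i ∈ X for some X with X ⊆ ⟦v⟧X).
ν : {I : Set} → IC I → I → Set₁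
ν {I} v i = Σ (I → Set) λ X → ((j : I) → X j → ⟦ v ⟧ X j) × X i

νintro : {I : Set} {v : IC I} {X : I → Set} →
         (c : (i : I) → X i → ⟦ v ⟧ X i) → (i : I) → X i → ν v i
νintro {X = X} c i x = X , c , x

νelim : {I : Set} {v : IC I} (i : I) → ν v i → ⟦ v ⟧ (ν v) i
νelim {v = v} i (X , c , x) =
  proj₁ (c i x) , λ d → X , c , proj₂ (c i x) d

record LinSim {I₁ I₂ : Set} (w₁ : IC I₁) (w₂ : IC I₂) : Set₁ where
  field
    R : I₁ → I₂ → Set
    ρ : (i₁ : I₁) (i₂ : I₂) → R i₁ i₂ →
        (a₂ : A w₂ i₂) → Σ (A w₁ i₁) λ a₁ → (d₁ : D w₁ i₁ a₁) →
        Σ (D w₂ i₂ a₂) λ d₂ → R (n w₁ i₁ a₁ d₁) (n w₂ i₂ a₂ d₂)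
open LinSim public

-- A point of w^⊥ is a strategy f choosing a direction f a for every shape a.
-- Given a w₂-shape a₂, the simulation supplies a w₁-shape a₁; the w₁-strategy
-- answers with f a₁, and the simulation translates that answer into a
-- w₂-direction whose target stays R-related to the w₁-target.  Hence the
-- R-image of a post-fixed point of ⟦w₁⊥⟧ is a post-fixed point of ⟦w₂⊥⟧.
module Submission where

open import Defs
open import Data.Product using (Σ; _×_; _,_; proj₁; proj₂)

module _ {I₁ I₂ : Set} {w₁ : IC I₁} {w₂ : IC I₂} (s : LinSim w₁ w₂) where

  image : (I₁ → Set) → I₂ → Set
  image X i₂ = Σ I₁ λ i₁ → R s i₁ i₂ × X i₁

  ⟦⊥⟧-image : {X : I₁ → Set} {i₁ : I₁} {i₂ : I₂} → R s i₁ i₂ →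
              ⟦ w₁ ⊥ ⟧ X i₁ → ⟦ w₂ ⊥ ⟧ (image X) i₂
  ⟦⊥⟧-image {X} {i₁} {i₂} r (f , next) = strategy , continue
    where
    shape₁ : A w₂ i₂ → A w₁ i₁
    shape₁ a₂ = proj₁ (ρ s i₁ i₂ r a₂)

    answer : (a₂ : A w₂ i₂) →
             Σ (D w₂ i₂ a₂) λ d₂ → R s (n w₁ i₁ (shape₁ a₂) (f (shape₁ a₂))) (n w₂ i₂ a₂ d₂)
    answer a₂ = proj₂ (ρ s i₁ i₂ r a₂) (f (shape₁ a₂))

    strategy : (a₂ : A w₂ i₂) → D w₂ i₂ a₂
    strategy a₂ = proj₁ (answer a₂)

    continue : (a₂ : A w₂ i₂) → image X (n w₂ i₂ a₂ (strategy a₂))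
    continue a₂ = _ , proj₂ (answer a₂) , next (shape₁ a₂)

  image-postfixed : {X : I₁ → Set} → ((i₁ : I₁) → X i₁ → ⟦ w₁ ⊥ ⟧ X i₁) →
                    (i₂ : I₂) → image X i₂ → ⟦ w₂ ⊥ ⟧ (image X) i₂
  image-postfixed c i₂ (i₁ , r , x) = ⟦⊥⟧-image r (c i₁ x)

lemma4p3 : {I₁ I₂ : Set} (w₁ : IC I₁) (w₂ : IC I₂) (s : LinSim w₁ w₂) →
    (i₁ : I₁) (i₂ : I₂) → R s i₁ i₂ → ν (w₁ ⊥) i₁ → ν (w₂ ⊥) i₂
lemma4p3 w₁ w₂ s i₁ i₂ r (X , c , x) =
  νintro (image-postfixed s c) i₂ (i₁ , r , x)
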